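{- Let $q$ be a prime power, $r=q^2+q+1$, and let $\psi$ be any bijection from the points of $\mathrm{PG}(2,q)$ to $[r]$. Let $L$ be the set of images under $\psi$ of the lines, and write each $\ell\in L$ as $\{\ell_0<\ell_1<\dots<\ell_q\}$. Define \begin{align*} E_1&=\sum_{\ell\in L}\sum_{i=0}^q \binom{q-i}{2}(\ell_i-i),\\ E_2&=\sum_{\ell\in L}\sum_{i=0}^q \left(i(q-i)-\binom{q-i}{2}\right)(\ell_i-i),\\ E_3&=\sum_{\ell\in L}\sum_{i=0}^q \left(\binom{i}{2}-i(q-i)\right)(\ell_i-i),\\ E_4&=\sum_{\ell\in L}\sum_{i=0}^q \binom{i}{2}\left(q^2-(\ell_i-i)\right), \end{align*} and $E_5=\frac{(q^2+q+1)q^3(q+1)(q-1)}{6}$. Then $E_1+E_4=E_2+E_3=E_5/2$.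
   Context: $\mathrm{PG}(2,q)$ is the projective plane over $\mathrm{GF}(q)$ (points: 1-dimensional subspaces of $\mathrm{GF}(q)^3$; lines: point sets of 2-dimensional subspaces). $[r]=\{0,\dots,r-1\}$. -}

module Defs where

open import Level using (0ℓ)
open import Algebra.Bundles using (CommutativeRing)
open import Data.Nat as ℕ using (ℕ; zero; suc; _∸_)
open import Data.Nat.Combinatorics using (_C_)
open import Data.Integer as ℤ using (ℤ; +_)
open import Data.Fin using (Fin; toℕ)
open import Data.Fin.Subset using (Subset; _∈_)
open import Data.Fin.Subset.Properties using (_∈?_)
open import Data.List using (List; []; _∷_; filter; allFin)
open import Data.Product using (_×_; _,_; ∃; ∃-syntax)
open import Relation.Nullary using (¬_)
open import Relation.Binary.PropositionalEquality as ≡ using (_≡_)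
open import Function.Bundles using (Bijection; _⇔_)

record FiniteField (q : ℕ) : Set₁ where
  field
    commRing : CommutativeRing 0ℓ 0ℓ
  open CommutativeRing commRing public
  field
    0≉1     : ¬ (0# ≈ 1#)
    inverse : ∀ x → ¬ (x ≈ 0#) → ∃[ y ] (x * y ≈ 1#)
    enum    : Bijection setoid (≡.setoid (Fin q))

module PG {q : ℕ} (F : FiniteField q) where
  open FiniteField F

  V : Set
  V = Carrier × Carrier × Carrier

  _≈V_ : V → V → Set
  (x₁ , x₂ , x₃) ≈V (y₁ , y₂ , y₃) = (x₁ ≈ y₁) × (x₂ ≈ y₂) × (x₃ ≈ y₃)

  zeroV : V
  zeroV = 0# , 0# , 0#

  _·_ : Carrier → V → V
  a · (x₁ , x₂ , x₃) = a * x₁ , a * x₂ , a * x₃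

  _⊕_ : V → V → V
  (x₁ , x₂ , x₃) ⊕ (y₁ , y₂ , y₃) = x₁ + y₁ , x₂ + y₂ , x₃ + y₃

  NonZeroV : V → Set
  NonZeroV v = ¬ (v ≈V zeroV)

  SamePoint : V → V → Set
  SamePoint u v = ∃[ c ] (u ≈V (c · v))

  -- ψ is a bijection from the points of PG(2,q) (1-dim subspaces, represented
  -- by nonzero vectors up to scalars) to Fin r: it identifies exactly the
  -- vectors spanning the same subspace, and is onto.
  IsPointBijection : {r : ℕ} → ((v : V) → NonZeroV v → Fin r) → Set
  IsPointBijection {r} ψ =
    (∀ u v (nu : NonZeroV u) (nv : NonZeroV v) → (ψ u nu ≡ ψ v nv) ⇔ SamePoint u v)
    × (∀ (k : Fin r) → ∃[ v ] ∃[ nv ] (ψ v nv ≡ k))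

  LinIndep : V → V → Set
  LinIndep u v = ∀ a b → ((a · u) ⊕ (b · v)) ≈V zeroV → (a ≈ 0#) × (b ≈ 0#)

  InSpan : V → V → V → Set
  InSpan u v x = ∃[ a ] ∃[ b ] (x ≈V ((a · u) ⊕ (b · v)))

  IsLineImage : {r : ℕ} → ((v : V) → NonZeroV v → Fin r) → Subset r → Set
  IsLineImage {r} ψ ℓ =
    ∃[ u ] ∃[ v ] (LinIndep u v ×
      (∀ (k : Fin r) → (k ∈ ℓ) ⇔ (∃[ x ] ∃[ nx ] (InSpan u v x × (ψ x nx ≡ k)))))

-- the elements of a subset of Fin r, in increasing order: ℓ₀ < ℓ₁ < …
sortedElems : {r : ℕ} → Subset r → List (Fin r)
sortedElems {r} ℓ = filter (_∈? ℓ) (allFin r)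

sumIdx : {r : ℕ} → (ℕ → ℕ → ℤ) → ℕ → List (Fin r) → ℤ
sumIdx f i []       = + 0
sumIdx f i (x ∷ xs) = f i (toℕ x) ℤ.+ sumIdx f (suc i) xs

sumLines : {r : ℕ} → (ℕ → ℕ → ℤ) → List (Subset r) → ℤ
sumLines f []       = + 0
sumLines f (ℓ ∷ ls) = sumIdx f 0 (sortedElems ℓ) ℤ.+ sumLines f ls

d : ℕ → ℕ → ℤ
d i x = + x ℤ.- + i

E₁ E₂ E₃ E₄ : ℕ → {r : ℕ} → List (Subset r) → ℤ
E₁ q = sumLines (λ i x → + ((q ∸ i) C 2) ℤ.* d i x)
E₂ q = sumLines (λ i x → (+ (i ℕ.* (q ∸ i)) ℤ.- + ((q ∸ i) C 2)) ℤ.* d i x)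
E₃ q = sumLines (λ i x → (+ (i C 2) ℤ.- + (i ℕ.* (q ∸ i))) ℤ.* d i x)
E₄ q = sumLines (λ i x → + (i C 2) ℤ.* (+ (q ℕ.^ 2) ℤ.- d i x))

rOf : ℕ → ℕ
rOf q = q ℕ.^ 2 ℕ.+ q ℕ.+ 1

-- E₅ = (q²+q+1) q³ (q+1)(q-1) / 6  (an exact division)
E₅ : ℕ → ℤ
E₅ q = + ((rOf q ℕ.* q ℕ.^ 3 ℕ.* (q ℕ.+ 1) ℕ.* (q ∸ 1)) ℕ./ 6)

module Submission where

-- Only two facts about the lines of PG(2,q) are needed: each has q + 1 points, and two distinct
-- points lie on exactly one line, so the lines form a Steiner system S(2, q+1, q²+q+1).
-- Summand by summand, E₁ + E₂ + E₃ + E₄ = Σ_ℓ Σ_i C(i,2) q², which depends only on the line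
-- sizes, and 2(E₂ + E₃) = (q−1) Σ_ℓ Σ_i (2i−q)(ℓᵢ−i). For a sorted line, Σ_i (2i−q) ℓᵢ is the sum
-- of the gaps ℓⱼ − ℓᵢ over its pairs i < j; as every pair of points lies on exactly one line,
-- summing over all lines gives Σ_{a<b<r} (b−a) = (r+1) r (r−1) / 6. The same double counting of
-- pairs shows that there are r lines, and the rest is polynomial arithmetic in q.

open import Defs
open import Data.Nat using (ℕ)

module Counting where
  open import Data.Nat as ℕ using (zero; suc; _∸_)
  open import Data.Nat.Combinatorics using (_C_; nCk+nC[k+1]≡[n+1]C[k+1]; nC1≡n)
  import Data.Nat.Properties as ℕP
  import Data.Nat.DivMod as ℕDM
  open import Data.Integer as ℤ using (ℤ; +_; _+_; _*_; _-_; -_)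
  import Data.Integer.Properties as ℤP
  open import Data.Integer.Tactic.RingSolver using (solve-∀)
  open import Data.Bool using (if_then_else_)
  open import Data.Fin as Fin using (Fin; toℕ)
  open import Data.Fin.Properties using (_≟_)
  open import Data.Fin.Subset using (Subset; inside; outside) renaming (_∈_ to _∈ₛ_)
  open import Data.Fin.Subset.Properties using (_∈?_; ⊆-antisym)
  import Data.Vec as Vec
  import Data.Vec.Properties as Vecₚ
  open import Data.List using (List; []; _∷_; filter; allFin; length; tabulate)
  open import Data.List.Properties using (length-tabulate)
  open import Data.List.Membership.Propositional using (_∈_)
  open import Data.List.Membership.Propositional.Properties using (∈-allFin)
  open import Data.List.Relation.Unary.All as All using (All; []; _∷_)
  open import Data.List.Relation.Unary.AllPairs using (AllPairs; []; _∷_)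
  open import Data.List.Relation.Unary.Any using (here; there)
  open import Data.List.Relation.Unary.Unique.Propositional using (Unique)
  open import Data.List.Relation.Unary.Unique.Propositional.Properties using (allFin⁺)
  open import Data.Product using (_×_; _,_; ∃-syntax)
  open import Data.Empty using (⊥-elim)
  open import Function.Bundles using (_⇔_; mk⇔; Equivalence)
  open import Relation.Nullary using (Dec; yes; no; does; ¬_)
  open import Relation.Unary using (Decidable)
  open import Relation.Binary.Definitions using (DecidableEquality)
  open import Relation.Binary.PropositionalEquality

  private
    variable
      A B : Set
      r : ℕ

  sum : (A → ℤ) → List A → ℤ
  sum f []       = + 0
  sum f (x ∷ xs) = f x + sum f xs

  sumPairs : (A → A → ℤ) → List A → ℤ
  sumPairs g []       = + 0
  sumPairs g (x ∷ xs) = sum (g x) xs + sumPairs g xs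

  𝟙 : {P : Set} → Dec P → ℤ
  𝟙 (yes _) = + 1
  𝟙 (no _)  = + 0

  private
    zero-+ : ∀ {a b} → a ≡ + 0 → a + b ≡ b
    zero-+ refl = ℤP.+-identityˡ _

    interchange : ∀ a b c d → (a + b) + (c + d) ≡ (a + c) + (b + d)
    interchange = solve-∀

  sum-const : (c : ℤ) (xs : List A) → sum (λ _ → c) xs ≡ + length xs * c
  sum-const c []       = refl
  sum-const c (x ∷ xs) = begin
    c + sum (λ _ → c) xs       ≡⟨ cong (λ t → c + t) (sum-const c xs) ⟩
    c + + length xs * c        ≡⟨ cong (_+ + length xs * c) (ℤP.*-identityˡ c) ⟨
    + 1 * c + + length xs * c  ≡⟨ ℤP.*-distribʳ-+ c (+ 1) (+ length xs) ⟨
    + length (x ∷ xs) * c      ∎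
    where open ≡-Reasoning

  sum-0 : (xs : List A) → sum (λ _ → + 0) xs ≡ + 0
  sum-0 xs = trans (sum-const (+ 0) xs) (ℤP.*-zeroʳ (+ length xs))

  sum-1 : (xs : List A) → sum (λ _ → + 1) xs ≡ + length xs
  sum-1 xs = trans (sum-const (+ 1) xs) (ℤP.*-identityʳ (+ length xs))

  sum-cong : {f g : A → ℤ} (xs : List A) → (∀ x → f x ≡ g x) → sum f xs ≡ sum g xs
  sum-cong []       e = refl
  sum-cong (x ∷ xs) e = cong₂ _+_ (e x) (sum-cong xs e)

  sum-congᴬ : {f g : A → ℤ} {xs : List A} → All (λ x → f x ≡ g x) xs → sum f xs ≡ sum g xs
  sum-congᴬ []       = refl
  sum-congᴬ (p ∷ ps) = cong₂ _+_ p (sum-congᴬ ps)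

  sum-+ : (f g : A → ℤ) (xs : List A) → sum (λ x → f x + g x) xs ≡ sum f xs + sum g xs
  sum-+ f g []       = refl
  sum-+ f g (x ∷ xs) rewrite sum-+ f g xs = interchange (f x) (g x) (sum f xs) (sum g xs)

  sum-*ˡ : (c : ℤ) (f : A → ℤ) (xs : List A) → sum (λ x → c * f x) xs ≡ c * sum f xs
  sum-*ˡ c f []       = sym (ℤP.*-zeroʳ c)
  sum-*ˡ c f (x ∷ xs) rewrite sum-*ˡ c f xs = sym (ℤP.*-distribˡ-+ c (f x) (sum f xs))

  sum-swap : (f : A → B → ℤ) (xs : List A) (ys : List B) →
    sum (λ x → sum (f x) ys) xs ≡ sum (λ y → sum (λ x → f x y) xs) ys
  sum-swap f []       ys = sym (sum-0 ys)
  sum-swap f (x ∷ xs) ys rewrite sum-swap f xs ys = sym (sum-+ (f x) (λ y → sum (λ x → f x y) xs) ys)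

  sum-filter : {P : A → Set} (P? : Decidable P) (f : A → ℤ) (xs : List A) →
    sum f (filter P? xs) ≡ sum (λ x → 𝟙 (P? x) * f x) xs
  sum-filter P? f []       = refl
  sum-filter P? f (x ∷ xs) with P? x
  ... | yes _ = cong₂ _+_ (sym (ℤP.*-identityˡ (f x))) (sum-filter P? f xs)
  ... | no _  = trans (sum-filter P? f xs) (sym (zero-+ (ℤP.*-zeroˡ (f x))))

  sumPairs-filter : {P : A → Set} (P? : Decidable P) (g : A → A → ℤ) (xs : List A) →
    sumPairs g (filter P? xs) ≡ sumPairs (λ x y → 𝟙 (P? x) * (𝟙 (P? y) * g x y)) xs
  sumPairs-filter P? g []       = refl
  sumPairs-filter P? g (x ∷ xs) with P? x
  ... | yes _ = cong₂ _+_
    (trans (sum-filter P? (g x) xs) (sum-cong xs (λ y → sym (ℤP.*-identityˡ _))))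
    (sumPairs-filter P? g xs)
  ... | no _  = trans (sumPairs-filter P? g xs)
    (sym (zero-+ (trans (sum-cong xs (λ y → ℤP.*-zeroˡ (𝟙 (P? y) * g x y))) (sum-0 xs))))

  sumPairs-cong : {R : A → A → Set} {g h : A → A → ℤ} {xs : List A} → AllPairs R xs →
    (∀ {x y} → R x y → g x y ≡ h x y) → sumPairs g xs ≡ sumPairs h xs
  sumPairs-cong []       e = refl
  sumPairs-cong (p ∷ ps) e = cong₂ _+_ (sum-congᴬ (All.map e p)) (sumPairs-cong ps e)

  sum-sumPairs-swap : (G : B → A → A → ℤ) (ys : List B) (xs : List A) →
    sum (λ y → sumPairs (G y) xs) ys ≡ sumPairs (λ a b → sum (λ y → G y a b) ys) xs
  sum-sumPairs-swap G ys []       = sum-0 ys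
  sum-sumPairs-swap G ys (x ∷ xs) =
    trans (sum-+ (λ y → sum (G y x) xs) (λ y → sumPairs (G y) xs) ys)
      (cong₂ _+_ (sum-swap (λ y → G y x) ys xs) (sum-sumPairs-swap G ys xs))

  sumPairs-1 : (xs : List A) → sumPairs (λ _ _ → + 1) xs * + 2 ≡ + length xs * (+ length xs - + 1)
  sumPairs-1 []       = refl
  sumPairs-1 (x ∷ xs) = begin
    (sum (λ _ → + 1) xs + sumPairs (λ _ _ → + 1) xs) * + 2
      ≡⟨ ℤP.*-distribʳ-+ (+ 2) (sum (λ _ → + 1) xs) _ ⟩
    sum (λ _ → + 1) xs * + 2 + sumPairs (λ _ _ → + 1) xs * + 2
      ≡⟨ cong₂ (λ a b → a * + 2 + b) (sum-1 xs) (sumPairs-1 xs) ⟩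
    n * + 2 + n * (n - + 1)
      ≡⟨ step n ⟩
    (+ 1 + n) * ((+ 1 + n) - + 1)
      ≡⟨ cong (λ t → t * (t - + 1)) (ℤP.pos-+ 1 (length xs)) ⟨
    + length (x ∷ xs) * (+ length (x ∷ xs) - + 1) ∎
    where
    open ≡-Reasoning
    n = + length xs
    step : ∀ n → n * + 2 + n * (n - + 1) ≡ (+ 1 + n) * ((+ 1 + n) - + 1)
    step = solve-∀

  sum-𝟙-≟ : (_≟_ : DecidableEquality A) (y : A) {xs : List A} → Unique xs → y ∈ xs →
    sum (λ x → 𝟙 (x ≟ y)) xs ≡ + 1
  sum-𝟙-≟ _≟_ y (x∉xs ∷ _) (here refl) with y ≟ y
  ... | yes _   = cong (λ t → + 1 + t) (absent x∉xs)
    where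
    absent : ∀ {xs} → All (λ z → ¬ y ≡ z) xs → sum (λ z → 𝟙 (z ≟ y)) xs ≡ + 0
    absent []                 = refl
    absent {z ∷ _} (y≢z ∷ ps) with z ≟ y
    ... | yes z≡y = ⊥-elim (y≢z (sym z≡y))
    ... | no _    = trans (ℤP.+-identityˡ _) (absent ps)
  ... | no y≢y = ⊥-elim (y≢y refl)
  sum-𝟙-≟ _≟_ y {x ∷ _} (x∉xs ∷ u) (there y∈xs) with x ≟ y
  ... | yes refl = ⊥-elim (All.lookup x∉xs y∈xs refl)
  ... | no _     = trans (ℤP.+-identityˡ _) (sum-𝟙-≟ _≟_ y u y∈xs)

  sumIdx-+ : (f g : ℕ → ℕ → ℤ) (k : ℕ) (xs : List (Fin r)) →
    sumIdx (λ i x → f i x + g i x) k xs ≡ sumIdx f k xs + sumIdx g k xs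
  sumIdx-+ f g k []       = refl
  sumIdx-+ f g k (x ∷ xs) rewrite sumIdx-+ f g (suc k) xs =
    interchange (f k (toℕ x)) (g k (toℕ x)) (sumIdx f (suc k) xs) (sumIdx g (suc k) xs)

  sumIdx-*ˡ : (c : ℤ) (f : ℕ → ℕ → ℤ) (k : ℕ) (xs : List (Fin r)) →
    sumIdx (λ i x → c * f i x) k xs ≡ c * sumIdx f k xs
  sumIdx-*ˡ c f k []       = sym (ℤP.*-zeroʳ c)
  sumIdx-*ˡ c f k (x ∷ xs) rewrite sumIdx-*ˡ c f (suc k) xs =
    sym (ℤP.*-distribˡ-+ c (f k (toℕ x)) (sumIdx f (suc k) xs))

  sumIdx-cong : {f g : ℕ → ℕ → ℤ} (k : ℕ) (xs : List (Fin r)) →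
    (∀ i x → i ℕ.< k ℕ.+ length xs → f i x ≡ g i x) → sumIdx f k xs ≡ sumIdx g k xs
  sumIdx-cong k []       e = refl
  sumIdx-cong k (x ∷ xs) e rewrite ℕP.+-suc k (length xs) =
    cong₂ _+_ (e k (toℕ x) (ℕ.s≤s (ℕP.m≤m+n k (length xs)))) (sumIdx-cong (suc k) xs e)

  sumIdx-telescope : (φ Φ : ℤ → ℤ) (c : ℤ) → (∀ K → φ K * c ≡ Φ (K + + 1) - Φ K) →
    (k : ℕ) (xs : List (Fin r)) →
    sumIdx (λ i _ → φ (+ i)) k xs * c ≡ Φ (+ (k ℕ.+ length xs)) - Φ (+ k)
  sumIdx-telescope φ Φ c step k [] rewrite ℕP.+-identityʳ k =
    trans (ℤP.*-zeroˡ c) (sym (ℤP.+-inverseʳ (Φ (+ k))))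
  sumIdx-telescope φ Φ c step k (x ∷ xs) rewrite ℕP.+-suc k (length xs) = begin
    (φ (+ k) + S) * c                           ≡⟨ ℤP.*-distribʳ-+ c (φ (+ k)) S ⟩
    φ (+ k) * c + S * c                         ≡⟨ cong₂ _+_ (step (+ k)) (sumIdx-telescope φ Φ c step (suc k) xs) ⟩
    (Φ (+ k + + 1) - Φ (+ k)) + (Φ end - Φ (+ suc k))
                                                ≡⟨ cong (λ t → (Φ t - Φ (+ k)) + (Φ end - Φ (+ suc k))) (ℤP.+-comm (+ k) (+ 1)) ⟩
    (Φ (+ suc k) - Φ (+ k)) + (Φ end - Φ (+ suc k))
                                                ≡⟨ cancel (Φ (+ k)) (Φ (+ suc k)) (Φ end) ⟩
    Φ end - Φ (+ k)                             ∎
    where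
    open ≡-Reasoning
    S   = sumIdx (λ i _ → φ (+ i)) (suc k) xs
    end = + (suc k ℕ.+ length xs)
    cancel : ∀ a b c → (b - a) + (c - b) ≡ c - a
    cancel = solve-∀

  pos : Fin r → ℤ
  pos x = + toℕ x

  gap : Fin r → Fin r → ℤ
  gap x y = pos y - pos x

  sum-gap : (x : Fin r) (xs : List (Fin r)) → sum (gap x) xs ≡ sum pos xs - + length xs * pos x
  sum-gap x []       = sym (ℤP.*-zeroˡ (pos x))
  sum-gap x (y ∷ ys) rewrite sum-gap x ys = step (pos y) (pos x) (sum pos ys) (+ length ys)
    where
    step : ∀ b a s m → (b - a) + (s - m * a) ≡ (b + s) - (+ 1 + m) * a
    step = solve-∀

  -- sumIdx-centred with the start index k and the offset c generalised, so that it goes by induction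
  sumIdx-weighted : (c : ℤ) (k : ℕ) (xs : List (Fin r)) →
    sumIdx (λ i x → (+ 2 * + i - c) * + x) k xs
      ≡ sumPairs gap xs + (+ 2 * + k + + length xs - + 1 - c) * sum pos xs
  sumIdx-weighted c k [] = sym (trans (ℤP.+-identityˡ _) (ℤP.*-zeroʳ (+ 2 * + k + + 0 - + 1 - c)))
  sumIdx-weighted c k (x ∷ xs) rewrite sumIdx-weighted c (suc k) xs | sum-gap x xs =
    step (+ k) (+ length xs) c (pos x) (sum pos xs) (sumPairs gap xs)
    where
    step : ∀ k n c x s P → (+ 2 * k - c) * x + (P + (+ 2 * (+ 1 + k) + n - + 1 - c) * s)
                         ≡ ((s - n * x) + P) + (+ 2 * k + (+ 1 + n) - + 1 - c) * (x + s)
    step = solve-∀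

  sumIdx-centred : (q : ℕ) (xs : List (Fin r)) → length xs ≡ suc q →
    sumIdx (λ i x → (+ 2 * + i - + q) * + x) 0 xs ≡ sumPairs gap xs
  sumIdx-centred q xs len = begin
    sumIdx (λ i x → (+ 2 * + i - + q) * + x) 0 xs
      ≡⟨ sumIdx-weighted (+ q) 0 xs ⟩
    sumPairs gap xs + (+ 2 * + 0 + + length xs - + 1 - + q) * sum pos xs
      ≡⟨ cong (λ n → sumPairs gap xs + (+ 2 * + 0 + + n - + 1 - + q) * sum pos xs) len ⟩
    sumPairs gap xs + (+ 2 * + 0 + (+ 1 + + q) - + 1 - + q) * sum pos xs
      ≡⟨ vanish (sumPairs gap xs) (+ q) (sum pos xs) ⟩
    sumPairs gap xs ∎
    where
    open ≡-Reasoning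
    vanish : ∀ P q s → P + (+ 2 * + 0 + (+ 1 + q) - + 1 - q) * s ≡ P
    vanish = solve-∀

  sumIdx-centred-index : (q : ℕ) (xs : List (Fin r)) → length xs ≡ suc q →
    sumIdx (λ i _ → (+ 2 * + i - + q) * + i) 0 xs * + 6 ≡ + q * (+ q + + 1) * (+ q + + 2)
  sumIdx-centred-index q xs len = begin
    sumIdx (λ i _ → φ (+ i)) 0 xs * + 6        ≡⟨ sumIdx-telescope φ Φ (+ 6) (step (+ q)) 0 xs ⟩
    Φ (+ length xs) - Φ (+ 0)                 ≡⟨ cong (λ n → Φ (+ n) - Φ (+ 0)) len ⟩
    Φ (+ 1 + + q) - Φ (+ 0)                   ≡⟨ value (+ q) ⟩
    + q * (+ q + + 1) * (+ q + + 2)           ∎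
    where
    open ≡-Reasoning
    φ Φ : ℤ → ℤ
    φ K = (+ 2 * K - + q) * K
    Φ K = + 2 * (K - + 1) * K * (+ 2 * K - + 1) - + 3 * + q * K * (K - + 1)
    step : ∀ q K → ((+ 2 * K - q) * K) * + 6
         ≡ (+ 2 * ((K + + 1) - + 1) * (K + + 1) * (+ 2 * (K + + 1) - + 1) - + 3 * q * (K + + 1) * ((K + + 1) - + 1))
           - (+ 2 * (K - + 1) * K * (+ 2 * K - + 1) - + 3 * q * K * (K - + 1))
    step = solve-∀
    value : ∀ q → (+ 2 * ((+ 1 + q) - + 1) * (+ 1 + q) * (+ 2 * (+ 1 + q) - + 1) - + 3 * q * (+ 1 + q) * ((+ 1 + q) - + 1))
                - (+ 2 * (+ 0 - + 1) * + 0 * (+ 2 * + 0 - + 1) - + 3 * q * + 0 * (+ 0 - + 1))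
                ≡ q * (q + + 1) * (q + + 2)
    value = solve-∀

  weight : ℕ → ℕ → ℕ → ℤ
  weight q i x = (+ 2 * + i - + q) * d i x

  sumIdx-weight : (q : ℕ) (xs : List (Fin r)) → length xs ≡ suc q →
    + 6 * sumIdx (weight q) 0 xs ≡ + 6 * sumPairs gap xs - + q * (+ q + + 1) * (+ q + + 2)
  sumIdx-weight q xs len = begin
    + 6 * sumIdx (weight q) 0 xs
      ≡⟨ cong (+ 6 *_) (sumIdx-cong 0 xs (λ i x _ → split (+ q) (+ i) (+ x))) ⟩
    + 6 * sumIdx (λ i x → centred i x + - + 1 * index i x) 0 xs
      ≡⟨ cong (+ 6 *_) (sumIdx-+ centred (λ i x → - + 1 * index i x) 0 xs) ⟩
    + 6 * (sumIdx centred 0 xs + sumIdx (λ i x → - + 1 * index i x) 0 xs)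
      ≡⟨ cong (λ t → + 6 * (sumIdx centred 0 xs + t)) (sumIdx-*ˡ (- + 1) index 0 xs) ⟩
    + 6 * (sumIdx centred 0 xs + - + 1 * sumIdx index 0 xs)
      ≡⟨ rearrange (sumIdx centred 0 xs) (sumIdx index 0 xs) ⟩
    + 6 * sumIdx centred 0 xs - sumIdx index 0 xs * + 6
      ≡⟨ cong₂ (λ a b → + 6 * a - b) (sumIdx-centred q xs len) (sumIdx-centred-index q xs len) ⟩
    + 6 * sumPairs gap xs - + q * (+ q + + 1) * (+ q + + 2) ∎
    where
    open ≡-Reasoning
    centred index : ℕ → ℕ → ℤ
    centred i x = (+ 2 * + i - + q) * + x
    index i _   = (+ 2 * + i - + q) * + i
    split : ∀ q i x → (+ 2 * i - q) * (x - i) ≡ (+ 2 * i - q) * x + - + 1 * ((+ 2 * i - q) * i)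
    split = solve-∀
    rearrange : ∀ a b → + 6 * (a + - + 1 * b) ≡ + 6 * a - b * + 6
    rearrange = solve-∀

  nC2*2≡n*[n-1] : ∀ n → + (n C 2) * + 2 ≡ + n * (+ n - + 1)
  nC2*2≡n*[n-1] zero    = refl
  nC2*2≡n*[n-1] (suc n) = begin
    + (suc n C 2) * + 2                  ≡⟨ cong (λ t → + t * + 2) (nCk+nC[k+1]≡[n+1]C[k+1] n 1) ⟨
    + (n C 1 ℕ.+ n C 2) * + 2            ≡⟨ cong (_* + 2) (ℤP.pos-+ (n C 1) (n C 2)) ⟩
    (+ (n C 1) + + (n C 2)) * + 2        ≡⟨ ℤP.*-distribʳ-+ (+ 2) (+ (n C 1)) (+ (n C 2)) ⟩
    + (n C 1) * + 2 + + (n C 2) * + 2    ≡⟨ cong₂ (λ a b → + a * + 2 + b) (nC1≡n n) (nC2*2≡n*[n-1] n) ⟩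
    + n * + 2 + + n * (+ n - + 1)        ≡⟨ step (+ n) ⟩
    (+ 1 + + n) * ((+ 1 + + n) - + 1)    ∎
    where
    open ≡-Reasoning
    step : ∀ n → n * + 2 + n * (n - + 1) ≡ (+ 1 + n) * ((+ 1 + n) - + 1)
    step = solve-∀

  sumIdx-C2 : (q : ℕ) (xs : List (Fin r)) → length xs ≡ suc q →
    + 6 * sumIdx (λ i _ → + (i C 2)) 0 xs ≡ (+ q - + 1) * + q * (+ q + + 1)
  sumIdx-C2 q xs len = begin
    + 6 * S                                          ≡⟨ regroup S ⟩
    (S * + 2) * + 3                                  ≡⟨ cong (_* + 3) (ℤP.*-comm S (+ 2)) ⟩
    (+ 2 * S) * + 3                                  ≡⟨ cong (_* + 3) (sumIdx-*ˡ (+ 2) (λ i _ → + (i C 2)) 0 xs) ⟨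
    sumIdx (λ i _ → + 2 * + (i C 2)) 0 xs * + 3      ≡⟨ cong (_* + 3) (sumIdx-cong 0 xs (λ i _ _ → trans (ℤP.*-comm (+ 2) (+ (i C 2))) (nC2*2≡n*[n-1] i))) ⟩
    sumIdx (λ i _ → φ (+ i)) 0 xs * + 3              ≡⟨ sumIdx-telescope φ Φ (+ 3) step 0 xs ⟩
    Φ (+ length xs) - Φ (+ 0)                        ≡⟨ cong (λ n → Φ (+ n) - Φ (+ 0)) len ⟩
    Φ (+ 1 + + q) - Φ (+ 0)                          ≡⟨ value (+ q) ⟩
    (+ q - + 1) * + q * (+ q + + 1)                  ∎
    where
    open ≡-Reasoning
    S = sumIdx (λ i _ → + (i C 2)) 0 xs
    φ Φ : ℤ → ℤ
    φ K = K * (K - + 1)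
    Φ K = (K - + 2) * (K - + 1) * K
    regroup : ∀ S → + 6 * S ≡ (S * + 2) * + 3
    regroup = solve-∀
    step : ∀ K → (K * (K - + 1)) * + 3 ≡ ((K + + 1) - + 2) * ((K + + 1) - + 1) * (K + + 1) - (K - + 2) * (K - + 1) * K
    step = solve-∀
    value : ∀ q → ((+ 1 + q) - + 2) * ((+ 1 + q) - + 1) * (+ 1 + q) - (+ 0 - + 2) * (+ 0 - + 1) * + 0 ≡ (q - + 1) * q * (q + + 1)
    value = solve-∀

  module _ {r : ℕ} where

    IsInterval : (c n : ℕ) → (Fin n → Fin r) → Set
    IsInterval c n f = ∀ i → toℕ (f i) ≡ c ℕ.+ toℕ i

    private
      shift : ∀ {c n} {f : Fin (suc n) → Fin r} → IsInterval c (suc n) f →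
              IsInterval (suc c) n (λ i → f (Fin.suc i))
      shift {c} I i = trans (I (Fin.suc i)) (ℕP.+-suc c (toℕ i))

      first : ∀ {c n} {f : Fin (suc n) → Fin r} → IsInterval c (suc n) f → pos (f Fin.zero) ≡ + c
      first {c} I = cong +_ (trans (I Fin.zero) (ℕP.+-identityʳ c))

    sum-pos-interval : ∀ c n (f : Fin n → Fin r) → IsInterval c n f →
      sum pos (tabulate f) * + 2 ≡ + n * (+ 2 * + c + + n - + 1)
    sum-pos-interval c zero    f I = refl
    sum-pos-interval c (suc n) f I = begin
      (pos (f Fin.zero) + S) * + 2                 ≡⟨ ℤP.*-distribʳ-+ (+ 2) (pos (f Fin.zero)) S ⟩
      pos (f Fin.zero) * + 2 + S * + 2             ≡⟨ cong₂ (λ a b → a * + 2 + b) (first I) (sum-pos-interval (suc c) n _ (shift I)) ⟩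
      + c * + 2 + + n * (+ 2 * (+ 1 + + c) + + n - + 1)
                                                   ≡⟨ step (+ c) (+ n) ⟩
      (+ 1 + + n) * (+ 2 * + c + (+ 1 + + n) - + 1) ∎
      where
      open ≡-Reasoning
      S = sum pos (tabulate (λ i → f (Fin.suc i)))
      step : ∀ c n → c * + 2 + n * (+ 2 * (+ 1 + c) + n - + 1) ≡ (+ 1 + n) * (+ 2 * c + (+ 1 + n) - + 1)
      step = solve-∀

    sumPairs-gap-interval : ∀ c n (f : Fin n → Fin r) → IsInterval c n f →
      sumPairs gap (tabulate f) * + 6 ≡ (+ n + + 1) * + n * (+ n - + 1)
    sumPairs-gap-interval c zero    f I = refl
    sumPairs-gap-interval c (suc n) f I = begin
      (sum (gap x) T + sumPairs gap T) * + 6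
        ≡⟨ cong (λ t → (t + sumPairs gap T) * + 6) (sum-gap x T) ⟩
      ((sum pos T - + length T * pos x) + sumPairs gap T) * + 6
        ≡⟨ cong₂ (λ m a → ((sum pos T - + m * a) + sumPairs gap T) * + 6) (length-tabulate (λ i → f (Fin.suc i))) (first I) ⟩
      ((sum pos T - + n * + c) + sumPairs gap T) * + 6
        ≡⟨ regroup (sum pos T) (+ n * + c) (sumPairs gap T) ⟩
      (sum pos T * + 2) * + 3 - + n * + c * + 6 + sumPairs gap T * + 6
        ≡⟨ cong₂ (λ a b → a * + 3 - + n * + c * + 6 + b)
             (sum-pos-interval (suc c) n _ (shift I)) (sumPairs-gap-interval (suc c) n _ (shift I)) ⟩
      (+ n * (+ 2 * (+ 1 + + c) + + n - + 1)) * + 3 - + n * + c * + 6 + (+ n + + 1) * + n * (+ n - + 1)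
        ≡⟨ step (+ n) (+ c) ⟩
      ((+ 1 + + n) + + 1) * (+ 1 + + n) * ((+ 1 + + n) - + 1) ∎
      where
      open ≡-Reasoning
      x = f Fin.zero
      T = tabulate (λ i → f (Fin.suc i))
      regroup : ∀ s m p → ((s - m) + p) * + 6 ≡ (s * + 2) * + 3 - m * + 6 + p * + 6
      regroup = solve-∀
      step : ∀ n c → (n * (+ 2 * (+ 1 + c) + n - + 1)) * + 3 - n * c * + 6 + (n + + 1) * n * (n - + 1)
                   ≡ ((+ 1 + n) + + 1) * (+ 1 + n) * ((+ 1 + n) - + 1)
      step = solve-∀

  sumPairs-gap-allFin : ∀ r → sumPairs gap (allFin r) * + 6 ≡ (+ r + + 1) * + r * (+ r - + 1)
  sumPairs-gap-allFin r = sumPairs-gap-interval 0 r (λ i → i) (λ i → refl)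

  subsetOf : {P : Fin r → Set} → Decidable P → Subset r
  subsetOf P? = Vec.tabulate (λ k → if does (P? k) then inside else outside)

  ∈-subsetOf : {P : Fin r → Set} (P? : Decidable P) (k : Fin r) → (k ∈ₛ subsetOf P?) ⇔ P k
  ∈-subsetOf {P = P} P? k = mk⇔ to from
    where
    to : k ∈ₛ subsetOf P? → P k
    to k∈ with P? k | trans (sym (Vecₚ.lookup∘tabulate _ k)) (Vecₚ.[]=⇒lookup k∈)
    ... | yes p | _ = p
    ... | no _  | ()
    from : P k → k ∈ₛ subsetOf P?
    from p = Vecₚ.lookup⇒[]= k _ (trans (Vecₚ.lookup∘tabulate _ k) (chosen (P? k)))
      where
      chosen : (d : Dec (P k)) → (if does d then inside else outside) ≡ inside
      chosen (yes _) = refl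
      chosen (no ¬p) = ⊥-elim (¬p p)

  length-sortedElems : (ℓ : Subset r) → + length (sortedElems ℓ) ≡ sum (λ k → 𝟙 (k ∈? ℓ)) (allFin r)
  length-sortedElems {r} ℓ = begin
    + length (sortedElems ℓ)                      ≡⟨ sum-1 (sortedElems ℓ) ⟨
    sum (λ _ → + 1) (sortedElems ℓ)               ≡⟨ sum-filter (_∈? ℓ) (λ _ → + 1) (allFin r) ⟩
    sum (λ k → 𝟙 (k ∈? ℓ) * + 1) (allFin r)       ≡⟨ sum-cong (allFin r) (λ k → ℤP.*-identityʳ (𝟙 (k ∈? ℓ))) ⟩
    sum (λ k → 𝟙 (k ∈? ℓ)) (allFin r)             ∎
    where open ≡-Reasoning

  length-sortedElems-image : {m : ℕ} (g : Fin m → Fin r) → (∀ {i j} → g i ≡ g j → i ≡ j) →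
    (ℓ : Subset r) → (∀ k → (k ∈ₛ ℓ) ⇔ (∃[ j ] g j ≡ k)) → length (sortedElems ℓ) ≡ m
  length-sortedElems-image {r} {m} g g-inj ℓ ∈ℓ⇔ = ℤP.+-injective (begin
    + length (sortedElems ℓ)                                   ≡⟨ length-sortedElems ℓ ⟩
    sum (λ k → 𝟙 (k ∈? ℓ)) (allFin r)                          ≡⟨ sum-cong (allFin r) preimages ⟩
    sum (λ k → sum (λ j → 𝟙 (k ≟ g j)) (allFin m)) (allFin r)  ≡⟨ sum-swap (λ k j → 𝟙 (k ≟ g j)) (allFin r) (allFin m) ⟩
    sum (λ j → sum (λ k → 𝟙 (k ≟ g j)) (allFin r)) (allFin m)  ≡⟨ sum-cong (allFin m) (λ j → sum-𝟙-≟ _≟_ (g j) (allFin⁺ r) (∈-allFin (g j))) ⟩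
    sum (λ _ → + 1) (allFin m)                                 ≡⟨ sum-1 (allFin m) ⟩
    + length (allFin m)                                        ≡⟨ cong +_ (length-tabulate {n = m} (λ i → i)) ⟩
    + m                                                        ∎)
    where
    open ≡-Reasoning
    preimages : ∀ k → 𝟙 (k ∈? ℓ) ≡ sum (λ j → 𝟙 (k ≟ g j)) (allFin m)
    preimages k with k ∈? ℓ
    ... | yes k∈ℓ with Equivalence.to (∈ℓ⇔ k) k∈ℓ
    ...   | j₀ , refl = sym (trans (sum-cong (allFin m) same) (sum-𝟙-≟ _≟_ j₀ (allFin⁺ m) (∈-allFin j₀)))
      where
      same : ∀ j → 𝟙 (g j₀ ≟ g j) ≡ 𝟙 (j ≟ j₀)
      same j with g j₀ ≟ g j | j ≟ j₀
      ... | yes _   | yes _   = refl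
      ... | no _    | no _    = refl
      ... | yes eq  | no j≢j₀ = ⊥-elim (j≢j₀ (g-inj (sym eq)))
      ... | no neq  | yes refl = ⊥-elim (neq refl)
    preimages k | no k∉ℓ = sym (trans (sum-cong (allFin m) absent) (sum-0 (allFin m)))
      where
      absent : ∀ j → 𝟙 (k ≟ g j) ≡ + 0
      absent j with k ≟ g j
      ... | yes k≡gj = ⊥-elim (k∉ℓ (Equivalence.from (∈ℓ⇔ k) (j , sym k≡gj)))
      ... | no _     = refl

  module _ {A : Set} {P Q : A → Set} (P? : Decidable P) (Q? : Decidable Q) (P⇒Q : ∀ {x} → P x → Q x) where

    length-filter-mono : (xs : List A) → length (filter P? xs) ℕ.≤ length (filter Q? xs)
    length-filter-mono []       = ℕ.z≤n
    length-filter-mono (x ∷ xs) with P? x | Q? x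
    ... | yes _  | yes _  = ℕ.s≤s (length-filter-mono xs)
    ... | yes px | no ¬qx = ⊥-elim (¬qx (P⇒Q px))
    ... | no _   | yes _  = ℕP.m≤n⇒m≤1+n (length-filter-mono xs)
    ... | no _   | no _   = length-filter-mono xs

    length-filter-≡⇒ : (xs : List A) → length (filter P? xs) ≡ length (filter Q? xs) →
      ∀ {x} → x ∈ xs → Q x → P x
    length-filter-≡⇒ (y ∷ xs) eq x∈ qx with P? y | Q? y | x∈
    ... | yes py | no ¬qy | _        = ⊥-elim (¬qy (P⇒Q py))
    ... | yes py | yes _  | here refl = py
    ... | yes _  | yes _  | there x∈′ = length-filter-≡⇒ xs (ℕP.suc-injective eq) x∈′ qx
    ... | no _   | yes _  | _        = ⊥-elim (ℕP.1+n≰n (subst (ℕ._≤ _) eq (length-filter-mono xs)))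
    ... | no ¬py | no ¬qy | here refl = ⊥-elim (¬qy qx)
    ... | no _   | no _   | there x∈′ = length-filter-≡⇒ xs eq x∈′ qx

  ⊆-length-sortedElems⇒≡ : (ℓ₀ ℓ : Subset r) → (∀ {k} → k ∈ₛ ℓ₀ → k ∈ₛ ℓ) →
    length (sortedElems ℓ₀) ≡ length (sortedElems ℓ) → ℓ₀ ≡ ℓ
  ⊆-length-sortedElems⇒≡ {r} ℓ₀ ℓ ℓ₀⊆ℓ eq =
    ⊆-antisym ℓ₀⊆ℓ (λ {k} → length-filter-≡⇒ (_∈? ℓ₀) (_∈? ℓ) ℓ₀⊆ℓ (allFin r) eq (∈-allFin k))

  sumLines≡sum : (f : ℕ → ℕ → ℤ) (L : List (Subset r)) →
    sumLines f L ≡ sum (λ ℓ → sumIdx f 0 (sortedElems ℓ)) L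
  sumLines≡sum f []      = refl
  sumLines≡sum f (ℓ ∷ L) = cong (λ t → sumIdx f 0 (sortedElems ℓ) + t) (sumLines≡sum f L)

  sumLines-+ : (f g : ℕ → ℕ → ℤ) (L : List (Subset r)) →
    sumLines (λ i x → f i x + g i x) L ≡ sumLines f L + sumLines g L
  sumLines-+ f g L = trans (sumLines≡sum _ L) (trans
    (trans (sum-cong L (λ ℓ → sumIdx-+ f g 0 (sortedElems ℓ))) (sum-+ _ _ L))
    (sym (cong₂ _+_ (sumLines≡sum f L) (sumLines≡sum g L))))

  sumLines-*ˡ : (c : ℤ) (f : ℕ → ℕ → ℤ) (L : List (Subset r)) →
    sumLines (λ i x → c * f i x) L ≡ c * sumLines f L
  sumLines-*ˡ c f L = trans (sumLines≡sum _ L) (trans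
    (trans (sum-cong L (λ ℓ → sumIdx-*ˡ c f 0 (sortedElems ℓ))) (sum-*ˡ c _ L))
    (sym (cong (c *_) (sumLines≡sum f L))))

  sumLines-cong : {f g : ℕ → ℕ → ℤ} {q : ℕ} {L : List (Subset r)} →
    All (λ ℓ → length (sortedElems ℓ) ≡ suc q) L →
    (∀ i x → i ℕ.≤ q → f i x ≡ g i x) → sumLines f L ≡ sumLines g L
  sumLines-cong {L = []}    []         e = refl
  sumLines-cong {L = ℓ ∷ _} (len ∷ ps) e = cong₂ _+_
    (sumIdx-cong 0 (sortedElems ℓ) (λ i x i<n → e i x (ℕ.s≤s⁻¹ (subst (i ℕ.<_) len i<n))))
    (sumLines-cong ps e)

  record IsSteinerSystem (k : ℕ) {r : ℕ} (L : List (Subset r)) : Set where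
    field
      block-size  : All (λ ℓ → length (sortedElems ℓ) ≡ k) L
      pair-unique : ∀ {a b} → a ≢ b → sum (λ ℓ → 𝟙 (a ∈? ℓ) * 𝟙 (b ∈? ℓ)) L ≡ + 1

  module _ {k r : ℕ} {L : List (Subset r)} (S : IsSteinerSystem k L) where
    open IsSteinerSystem S

    sum-sumPairs-blocks : (g : Fin r → Fin r → ℤ) →
      sum (λ ℓ → sumPairs g (sortedElems ℓ)) L ≡ sumPairs g (allFin r)
    sum-sumPairs-blocks g = begin
      sum (λ ℓ → sumPairs g (sortedElems ℓ)) L
        ≡⟨ sum-cong L (λ ℓ → sumPairs-filter (_∈? ℓ) g (allFin r)) ⟩
      sum (λ ℓ → sumPairs (λ a b → 𝟙 (a ∈? ℓ) * (𝟙 (b ∈? ℓ) * g a b)) (allFin r)) L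
        ≡⟨ sum-sumPairs-swap (λ ℓ a b → 𝟙 (a ∈? ℓ) * (𝟙 (b ∈? ℓ) * g a b)) L (allFin r) ⟩
      sumPairs (λ a b → sum (λ ℓ → 𝟙 (a ∈? ℓ) * (𝟙 (b ∈? ℓ) * g a b)) L) (allFin r)
        ≡⟨ sumPairs-cong (allFin⁺ r) covered-once ⟩
      sumPairs g (allFin r) ∎
      where
      open ≡-Reasoning
      covered-once : ∀ {a b} → a ≢ b → sum (λ ℓ → 𝟙 (a ∈? ℓ) * (𝟙 (b ∈? ℓ) * g a b)) L ≡ g a b
      covered-once {a} {b} a≢b = begin
        sum (λ ℓ → 𝟙 (a ∈? ℓ) * (𝟙 (b ∈? ℓ) * g a b)) L
          ≡⟨ sum-cong L (λ ℓ → reassoc (𝟙 (a ∈? ℓ)) (𝟙 (b ∈? ℓ)) (g a b)) ⟩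
        sum (λ ℓ → g a b * (𝟙 (a ∈? ℓ) * 𝟙 (b ∈? ℓ))) L
          ≡⟨ sum-*ˡ (g a b) _ L ⟩
        g a b * sum (λ ℓ → 𝟙 (a ∈? ℓ) * 𝟙 (b ∈? ℓ)) L
          ≡⟨ cong (g a b *_) (pair-unique a≢b) ⟩
        g a b * + 1
          ≡⟨ ℤP.*-identityʳ (g a b) ⟩
        g a b ∎
        where
        reassoc : ∀ x y z → x * (y * z) ≡ z * (x * y)
        reassoc = solve-∀

    block-count : + length L * (+ k * (+ k - + 1)) ≡ + r * (+ r - + 1)
    block-count = begin
      + length L * (+ k * (+ k - + 1))                  ≡⟨ sum-const _ L ⟨
      sum (λ _ → + k * (+ k - + 1)) L                    ≡⟨ sum-congᴬ (All.map pairs-in-block block-size) ⟨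
      sum (λ ℓ → sumPairs one (sortedElems ℓ) * + 2) L   ≡⟨ sum-cong L (λ ℓ → ℤP.*-comm _ (+ 2)) ⟩
      sum (λ ℓ → + 2 * sumPairs one (sortedElems ℓ)) L   ≡⟨ sum-*ˡ (+ 2) _ L ⟩
      + 2 * sum (λ ℓ → sumPairs one (sortedElems ℓ)) L   ≡⟨ cong (+ 2 *_) (sum-sumPairs-blocks one) ⟩
      + 2 * sumPairs one (allFin r)                      ≡⟨ ℤP.*-comm (+ 2) _ ⟩
      sumPairs one (allFin r) * + 2                      ≡⟨ sumPairs-1 (allFin r) ⟩
      + length (allFin r) * (+ length (allFin r) - + 1)  ≡⟨ cong (λ n → + n * (+ n - + 1)) (length-tabulate {n = r} (λ i → i)) ⟩
      + r * (+ r - + 1)                                  ∎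
      where
      open ≡-Reasoning
      one : Fin r → Fin r → ℤ
      one _ _ = + 1
      pairs-in-block : ∀ {ℓ} → length (sortedElems ℓ) ≡ k → sumPairs one (sortedElems ℓ) * + 2 ≡ + k * (+ k - + 1)
      pairs-in-block {ℓ} len = trans (sumPairs-1 (sortedElems ℓ)) (cong (λ n → + n * (+ n - + 1)) len)

  pos-∸ : ∀ {m n} → n ℕ.≤ m → + (m ∸ n) ≡ + m - + n
  pos-∸ {m} {n} n≤m = sym (trans (ℤP.m-n≡m⊖n m n) (ℤP.⊖-≥ n≤m))

  pos-square : ∀ q → + (q ℕ.^ 2) ≡ + q * + q
  pos-square q = trans (ℤP.pos-* q (q ℕ.* 1)) (cong (λ t → + q * + t) (ℕP.*-identityʳ q))

  pos-rOf : ∀ q → + rOf q ≡ + q * + q + + q + + 1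
  pos-rOf q = trans (ℤP.pos-+ (q ℕ.^ 2 ℕ.+ q) 1)
    (cong (_+ + 1) (trans (ℤP.pos-+ (q ℕ.^ 2) q) (cong (_+ + q) (pos-square q))))

  E₅-numerator : ℕ → ℕ
  E₅-numerator q = rOf q ℕ.* q ℕ.^ 3 ℕ.* (q ℕ.+ 1) ℕ.* (q ∸ 1)

  pos-E₅-numerator : ∀ q → 1 ℕ.≤ q → let Q = + q in
    + E₅-numerator q ≡ (Q * Q + Q + + 1) * (Q * Q * Q) * (Q + + 1) * (Q - + 1)
  pos-E₅-numerator q 1≤q = begin
    + (rOf q ℕ.* q ℕ.^ 3 ℕ.* (q ℕ.+ 1) ℕ.* (q ∸ 1))
      ≡⟨ ℤP.pos-* (rOf q ℕ.* q ℕ.^ 3 ℕ.* (q ℕ.+ 1)) (q ∸ 1) ⟩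
    + (rOf q ℕ.* q ℕ.^ 3 ℕ.* (q ℕ.+ 1)) * + (q ∸ 1)
      ≡⟨ cong (_* + (q ∸ 1)) (ℤP.pos-* (rOf q ℕ.* q ℕ.^ 3) (q ℕ.+ 1)) ⟩
    + (rOf q ℕ.* q ℕ.^ 3) * + (q ℕ.+ 1) * + (q ∸ 1)
      ≡⟨ cong (λ t → t * + (q ℕ.+ 1) * + (q ∸ 1)) (ℤP.pos-* (rOf q) (q ℕ.^ 3)) ⟩
    + rOf q * + (q ℕ.^ 3) * + (q ℕ.+ 1) * + (q ∸ 1)
      ≡⟨ cong₂ (λ a b → a * b * + (q ℕ.+ 1) * + (q ∸ 1)) (pos-rOf q) pos-cube ⟩
    (Q * Q + Q + + 1) * (Q * Q * Q) * + (q ℕ.+ 1) * + (q ∸ 1)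
      ≡⟨ cong (λ t → (Q * Q + Q + + 1) * (Q * Q * Q) * + (q ℕ.+ 1) * t) (pos-∸ 1≤q) ⟩
    (Q * Q + Q + + 1) * (Q * Q * Q) * (Q + + 1) * (Q - + 1) ∎
    where
    open ≡-Reasoning
    Q = + q
    pos-cube : + (q ℕ.^ 3) ≡ Q * Q * Q
    pos-cube = trans (ℤP.pos-* q (q ℕ.^ 2)) (trans (cong (Q *_) (pos-square q)) (sym (ℤP.*-assoc Q Q Q)))

  six*x≡n⇒x≡n/6 : (x : ℤ) (n : ℕ) → + 6 * x ≡ + n → x ≡ + (n ℕ./ 6)
  six*x≡n⇒x≡n/6 (+ m)      n eq = cong +_ (sym (begin
    n ℕ./ 6          ≡⟨ cong (ℕ._/ 6) (ℤP.+-injective (trans (ℤP.pos-* 6 m) eq)) ⟨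
    (6 ℕ.* m) ℕ./ 6  ≡⟨ cong (ℕ._/ 6) (ℕP.*-comm 6 m) ⟩
    (m ℕ.* 6) ℕ./ 6  ≡⟨ ℕDM.m*n/n≡m m 6 ⟩
    m                ∎))
    where open ≡-Reasoning
  six*x≡n⇒x≡n/6 ℤ.-[1+ m ] n ()

  module _ (q : ℕ) (i x : ℕ) where
    private
      Q = + q
      a = + ((q ∸ i) C 2)
      b = + (i ℕ.* (q ∸ i))
      c = + (i C 2)

    E₂E₃-summand : i ℕ.≤ q → + 2 * ((b - a) * d i x + (c - b) * d i x) ≡ (Q - + 1) * weight q i x
    E₂E₃-summand i≤q = begin
      + 2 * ((b - a) * d i x + (c - b) * d i x)      ≡⟨ collect a b c (d i x) ⟩
      (c * + 2 - a * + 2) * d i x                    ≡⟨ cong₂ (λ s t → (s - t) * d i x) (nC2*2≡n*[n-1] i) (nC2*2≡n*[n-1] (q ∸ i)) ⟩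
      (+ i * (+ i - + 1) - + (q ∸ i) * (+ (q ∸ i) - + 1)) * d i x
                                                     ≡⟨ cong (λ t → (+ i * (+ i - + 1) - t * (t - + 1)) * d i x) (pos-∸ i≤q) ⟩
      (+ i * (+ i - + 1) - (Q - + i) * ((Q - + i) - + 1)) * d i x
                                                     ≡⟨ factor Q (+ i) (d i x) ⟩
      (Q - + 1) * weight q i x                       ∎
      where
      open ≡-Reasoning
      collect : ∀ a b c d → + 2 * ((b - a) * d + (c - b) * d) ≡ (c * + 2 - a * + 2) * d
      collect = solve-∀
      factor : ∀ q i d → (i * (i - + 1) - (q - i) * ((q - i) - + 1)) * d ≡ (q - + 1) * ((+ 2 * i - q) * d)
      factor = solve-∀

    E-summand-total :
      (a * d i x + c * (+ (q ℕ.^ 2) - d i x)) + ((b - a) * d i x + (c - b) * d i x) ≡ + (q ℕ.^ 2) * c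
    E-summand-total = cancel a b c (d i x) (+ (q ℕ.^ 2))
      where
      cancel : ∀ a b c d s → (a * d + c * (s - d)) + ((b - a) * d + (c - b) * d) ≡ s * c
      cancel = solve-∀

  module _ (p : ℕ) {L : List (Subset (rOf (suc p)))} (S : IsSteinerSystem (suc (suc p)) L) where
    open IsSteinerSystem S
    open ≡-Reasoning

    private
      q = suc p
      Q = + q
      R = Q * Q + Q + + 1

    length-blocks : + length L ≡ R
    length-blocks = ℤP.*-cancelʳ-≡ (+ length L) R ((Q + + 1) * Q) (begin
      + length L * ((Q + + 1) * Q)          ≡⟨ cong (+ length L *_) (shape Q) ⟩
      + length L * (+ suc q * (+ suc q - + 1)) ≡⟨ block-count S ⟩
      + rOf q * (+ rOf q - + 1)             ≡⟨ cong (λ t → t * (t - + 1)) (pos-rOf q) ⟩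
      R * (R - + 1)                         ≡⟨ shape′ Q ⟩
      R * ((Q + + 1) * Q)                   ∎)
      where
      shape : ∀ Q → (Q + + 1) * Q ≡ (+ 1 + Q) * ((+ 1 + Q) - + 1)
      shape = solve-∀
      shape′ : ∀ Q → (Q * Q + Q + + 1) * ((Q * Q + Q + + 1) - + 1) ≡ (Q * Q + Q + + 1) * ((Q + + 1) * Q)
      shape′ = solve-∀

    sum-weight : + 6 * sumLines (weight q) L ≡ R * (Q * Q * Q) * (Q + + 1)
    sum-weight = begin
      + 6 * sumLines (weight q) L
        ≡⟨ cong (+ 6 *_) (sumLines≡sum (weight q) L) ⟩
      + 6 * sum (λ ℓ → sumIdx (weight q) 0 (sortedElems ℓ)) L
        ≡⟨ sum-*ˡ (+ 6) _ L ⟨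
      sum (λ ℓ → + 6 * sumIdx (weight q) 0 (sortedElems ℓ)) L
        ≡⟨ sum-congᴬ (All.map (λ {ℓ} → sumIdx-weight q (sortedElems ℓ)) block-size) ⟩
      sum (λ ℓ → + 6 * sumPairs gap (sortedElems ℓ) - K) L
        ≡⟨ sum-+ _ _ L ⟩
      sum (λ ℓ → + 6 * sumPairs gap (sortedElems ℓ)) L + sum (λ _ → - K) L
        ≡⟨ cong₂ _+_ (sum-*ˡ (+ 6) _ L) (sum-const (- K) L) ⟩
      + 6 * sum (λ ℓ → sumPairs gap (sortedElems ℓ)) L + + length L * - K
        ≡⟨ cong₂ (λ s n → + 6 * s + n * - K) (sum-sumPairs-blocks S gap) length-blocks ⟩
      + 6 * sumPairs gap (allFin (rOf q)) + R * - K
        ≡⟨ cong (_+ R * - K) (trans (ℤP.*-comm (+ 6) (sumPairs gap (allFin (rOf q)))) (sumPairs-gap-allFin (rOf q))) ⟩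
      (+ rOf q + + 1) * + rOf q * (+ rOf q - + 1) + R * - K
        ≡⟨ cong (λ t → (t + + 1) * t * (t - + 1) + R * - K) (pos-rOf q) ⟩
      (R + + 1) * R * (R - + 1) + R * - K
        ≡⟨ simplify Q ⟩
      R * (Q * Q * Q) * (Q + + 1) ∎
      where
      K = Q * (Q + + 1) * (Q + + 2)
      simplify : ∀ Q → let R = Q * Q + Q + + 1 in
        (R + + 1) * R * (R - + 1) + R * - (Q * (Q + + 1) * (Q + + 2)) ≡ R * (Q * Q * Q) * (Q + + 1)
      simplify = solve-∀

    six-E₂E₃ : + 6 * (+ 2 * (E₂ q L + E₃ q L)) ≡ R * (Q * Q * Q) * (Q + + 1) * (Q - + 1)
    six-E₂E₃ = begin
      + 6 * (+ 2 * (E₂ q L + E₃ q L))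
        ≡⟨ cong (λ t → + 6 * (+ 2 * t)) (sumLines-+ _ _ L) ⟨
      + 6 * (+ 2 * sumLines (λ i x → f₂ i x + f₃ i x) L)
        ≡⟨ cong (+ 6 *_) (sumLines-*ˡ (+ 2) _ L) ⟨
      + 6 * sumLines (λ i x → + 2 * (f₂ i x + f₃ i x)) L
        ≡⟨ cong (+ 6 *_) (sumLines-cong block-size (λ i x → E₂E₃-summand q i x)) ⟩
      + 6 * sumLines (λ i x → (Q - + 1) * weight q i x) L
        ≡⟨ cong (+ 6 *_) (sumLines-*ˡ (Q - + 1) (weight q) L) ⟩
      + 6 * ((Q - + 1) * sumLines (weight q) L)
        ≡⟨ swap (Q - + 1) (sumLines (weight q) L) ⟩
      (Q - + 1) * (+ 6 * sumLines (weight q) L)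
        ≡⟨ cong ((Q - + 1) *_) sum-weight ⟩
      (Q - + 1) * (R * (Q * Q * Q) * (Q + + 1))
        ≡⟨ ℤP.*-comm (Q - + 1) _ ⟩
      R * (Q * Q * Q) * (Q + + 1) * (Q - + 1) ∎
      where
      f₂ f₃ : ℕ → ℕ → ℤ
      f₂ i x = (+ (i ℕ.* (q ∸ i)) - + ((q ∸ i) C 2)) * d i x
      f₃ i x = (+ (i C 2) - + (i ℕ.* (q ∸ i))) * d i x
      swap : ∀ a b → + 6 * (a * b) ≡ a * (+ 6 * b)
      swap = solve-∀

    six-E-total : + 6 * ((E₁ q L + E₄ q L) + (E₂ q L + E₃ q L)) ≡ R * (Q * Q * Q) * (Q + + 1) * (Q - + 1)
    six-E-total = begin
      + 6 * ((E₁ q L + E₄ q L) + (E₂ q L + E₃ q L))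
        ≡⟨ cong (+ 6 *_) (cong₂ _+_ (sumLines-+ _ _ L) (sumLines-+ _ _ L)) ⟨
      + 6 * (sumLines (λ i x → f₁ i x + f₄ i x) L + sumLines (λ i x → f₂ i x + f₃ i x) L)
        ≡⟨ cong (+ 6 *_) (sumLines-+ _ _ L) ⟨
      + 6 * sumLines (λ i x → (f₁ i x + f₄ i x) + (f₂ i x + f₃ i x)) L
        ≡⟨ cong (+ 6 *_) (sumLines-cong block-size (λ i x _ → E-summand-total q i x)) ⟩
      + 6 * sumLines (λ i _ → Q² * + (i C 2)) L
        ≡⟨ cong (+ 6 *_) (trans (sumLines-*ˡ Q² (λ i _ → + (i C 2)) L) (cong (Q² *_) (sumLines≡sum _ L))) ⟩
      + 6 * (Q² * sum C2s L)
        ≡⟨ swap Q² (sum C2s L) ⟩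
      Q² * (+ 6 * sum C2s L)
        ≡⟨ cong (Q² *_) (sum-*ˡ (+ 6) C2s L) ⟨
      Q² * sum (λ ℓ → + 6 * C2s ℓ) L
        ≡⟨ cong (Q² *_) (sum-congᴬ (All.map (λ {ℓ} → sumIdx-C2 q (sortedElems ℓ)) block-size)) ⟩
      Q² * sum (λ _ → (Q - + 1) * Q * (Q + + 1)) L
        ≡⟨ cong (Q² *_) (trans (sum-const _ L) (cong (_* ((Q - + 1) * Q * (Q + + 1))) length-blocks)) ⟩
      Q² * (R * ((Q - + 1) * Q * (Q + + 1)))
        ≡⟨ cong (λ t → t * (R * ((Q - + 1) * Q * (Q + + 1)))) (pos-square q) ⟩
      (Q * Q) * (R * ((Q - + 1) * Q * (Q + + 1)))
        ≡⟨ regroup Q R ⟩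
      R * (Q * Q * Q) * (Q + + 1) * (Q - + 1) ∎
      where
      Q² = + (q ℕ.^ 2)
      f₁ f₂ f₃ f₄ : ℕ → ℕ → ℤ
      f₁ i x = + ((q ∸ i) C 2) * d i x
      f₂ i x = (+ (i ℕ.* (q ∸ i)) - + ((q ∸ i) C 2)) * d i x
      f₃ i x = (+ (i C 2) - + (i ℕ.* (q ∸ i))) * d i x
      f₄ i x = + (i C 2) * (Q² - d i x)
      C2s : Subset (rOf q) → ℤ
      C2s ℓ = sumIdx (λ i _ → + (i C 2)) 0 (sortedElems ℓ)
      swap : ∀ a s → + 6 * (a * s) ≡ a * (+ 6 * s)
      swap = solve-∀
      regroup : ∀ Q R → (Q * Q) * (R * ((Q - + 1) * Q * (Q + + 1))) ≡ R * (Q * Q * Q) * (Q + + 1) * (Q - + 1)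
      regroup = solve-∀

    E-identities : (E₁ q L + E₄ q L ≡ E₂ q L + E₃ q L)
                 × (+ 2 * (E₁ q L + E₄ q L) ≡ E₅ q)
                 × (+ 2 * (E₂ q L + E₃ q L) ≡ E₅ q)
    E-identities = ℤP.*-cancelˡ-≡ (+ 2) _ _ (trans E₁E₄ (sym E₂E₃)) , E₁E₄ , E₂E₃
      where
      M = R * (Q * Q * Q) * (Q + + 1) * (Q - + 1)
      numerator : + E₅-numerator q ≡ M
      numerator = pos-E₅-numerator q (ℕ.s≤s ℕ.z≤n)
      E₂E₃ : + 2 * (E₂ q L + E₃ q L) ≡ E₅ q
      E₂E₃ = six*x≡n⇒x≡n/6 _ _ (trans six-E₂E₃ (sym numerator))
      E₁E₄ : + 2 * (E₁ q L + E₄ q L) ≡ E₅ q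
      E₁E₄ = six*x≡n⇒x≡n/6 _ _ (begin
        + 6 * (+ 2 * (E₁ q L + E₄ q L))
          ≡⟨ difference (E₁ q L + E₄ q L) (E₂ q L + E₃ q L) ⟩
        + 2 * (+ 6 * ((E₁ q L + E₄ q L) + (E₂ q L + E₃ q L))) - + 6 * (+ 2 * (E₂ q L + E₃ q L))
          ≡⟨ cong₂ (λ s t → + 2 * s - t) six-E-total six-E₂E₃ ⟩
        + 2 * M - M
          ≡⟨ twice-minus-once M ⟩
        M
          ≡⟨ numerator ⟨
        + E₅-numerator q ∎)
        where
        difference : ∀ a b → + 6 * (+ 2 * a) ≡ + 2 * (+ 6 * (a + b)) - + 6 * (+ 2 * b)
        difference = solve-∀
        twice-minus-once : ∀ m → + 2 * m - m ≡ m
        twice-minus-once = solve-∀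

module ProjectivePlane {q : ℕ} (F : FiniteField q) where
  open import Data.Nat using (suc)
  open import Data.Integer as ℤ using (+_)
  open import Data.Fin as Fin using (Fin)
  import Data.Fin.Properties as Fin
  open import Data.Fin.Subset using (Subset) renaming (_∈_ to _∈ₛ_)
  open import Data.Fin.Subset.Properties using (_∈?_)
  open import Data.Bool using () renaming (_≟_ to _≟ᵇ_)
  open import Data.Vec.Properties using (≡-dec)
  open import Data.List using (List; length)
  open import Data.List.Membership.Propositional using (_∈_)
  open import Data.List.Relation.Unary.All as All using ()
  open import Data.List.Relation.Unary.Unique.Propositional using (Unique)
  open import Data.Product using (_×_; _,_; proj₁; proj₂; ∃-syntax)
  open import Data.Empty using (⊥-elim)
  open import Function.Bundles using (_⇔_; mk⇔; Equivalence; Bijection)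
  open import Function.Properties.Equivalence using () renaming (sym to ⇔-sym; trans to ⇔-trans)
  open import Relation.Nullary using (Dec; yes; no; ¬_)
  open import Relation.Binary.Definitions using (DecidableEquality)
  open import Relation.Binary.PropositionalEquality as ≡ using (_≡_; _≢_)
  open import Algebra.Bundles using (AbelianGroup)
  open Counting
  open FiniteField F
  open PG F
  open import Algebra.Solver.Ring.NaturalCoefficients.Default commutativeSemiring
    using (solve; _:+_; _:*_; _:=_; con)
  open import Algebra.Properties.Group (AbelianGroup.group +-abelianGroup)
    using (inverseˡ-unique; x∙y⁻¹≈ε⇒x≈y)
  open import Algebra.Properties.Ring ring using (-‿distribˡ-*)
  open import Relation.Binary.Reasoning.Setoid setoid
  private module E = Bijection enum

  _≟F_ : ∀ x y → Dec (x ≈ y)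
  x ≟F y with E.to x Fin.≟ E.to y
  ... | yes eq  = yes (E.injective eq)
  ... | no  neq = no (λ x≈y → neq (E.cong x≈y))

  element : Fin q → Carrier
  element j = proj₁ (E.strictlySurjective j)

  to-element : ∀ j → E.to (element j) ≡ j
  to-element j = proj₂ (E.strictlySurjective j)

  element-injective : ∀ {i j} → element i ≈ element j → i ≡ j
  element-injective {i} {j} e = ≡.trans (≡.sym (to-element i)) (≡.trans (E.cong e) (to-element j))

  1≉0 : ¬ 1# ≈ 0#
  1≉0 1≈0 = 0≉1 (sym 1≈0)

  inverse-cancel : ∀ {a a′ x y} → a * a′ ≈ 1# → a * x ≈ y → x ≈ a′ * y
  inverse-cancel {a} {a′} {x} {y} aa′≈1 ax≈y = begin
    x              ≈⟨ *-identityˡ x ⟨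
    1# * x         ≈⟨ *-congʳ aa′≈1 ⟨
    (a * a′) * x   ≈⟨ solve 3 (λ a a′ x → (a :* a′) :* x := a′ :* (a :* x)) refl a a′ x ⟩
    a′ * (a * x)   ≈⟨ *-congˡ ax≈y ⟩
    a′ * y         ∎

  nonzero-*-cancel : ∀ {a y} → ¬ a ≈ 0# → a * y ≈ 0# → y ≈ 0#
  nonzero-*-cancel {a} {y} a≉0 ay≈0 with inverse a a≉0
  ... | a′ , aa′≈1 = trans (inverse-cancel aa′≈1 ay≈0) (zeroʳ a′)

  comb : V → V → Carrier → Carrier → V
  comb u v α β = (α · u) ⊕ (β · v)

  ≈V-sym : ∀ {x y} → x ≈V y → y ≈V x
  ≈V-sym (e₁ , e₂ , e₃) = sym e₁ , sym e₂ , sym e₃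

  ≈V-trans : ∀ {x y z} → x ≈V y → y ≈V z → x ≈V z
  ≈V-trans (e₁ , e₂ , e₃) (f₁ , f₂ , f₃) = trans e₁ f₁ , trans e₂ f₂ , trans e₃ f₃

  ·-congˡ : ∀ c {x y} → x ≈V y → (c · x) ≈V (c · y)
  ·-congˡ c (e₁ , e₂ , e₃) = *-congˡ e₁ , *-congˡ e₂ , *-congˡ e₃

  comb-cong : ∀ u v {α α′ β β′} → α ≈ α′ → β ≈ β′ → comb u v α β ≈V comb u v α′ β′
  comb-cong (u₁ , u₂ , u₃) (v₁ , v₂ , v₃) α≈ β≈ =
    +-cong (*-congʳ α≈) (*-congʳ β≈) , +-cong (*-congʳ α≈) (*-congʳ β≈) , +-cong (*-congʳ α≈) (*-congʳ β≈)

  ·-comb : ∀ c u v α β → (c · comb u v α β) ≈V comb u v (c * α) (c * β)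
  ·-comb c (u₁ , u₂ , u₃) (v₁ , v₂ , v₃) α β = law u₁ v₁ , law u₂ v₂ , law u₃ v₃
    where
    law : ∀ x y → c * (α * x + β * y) ≈ (c * α) * x + (c * β) * y
    law = solve 5 (λ c α β x y → c :* (α :* x :+ β :* y) := (c :* α) :* x :+ (c :* β) :* y) refl c α β

  comb-comb : ∀ {u v u′ v′ α₁ β₁ α₂ β₂} a b → u ≈V comb u′ v′ α₁ β₁ → v ≈V comb u′ v′ α₂ β₂ →
    comb u v a b ≈V comb u′ v′ (a * α₁ + b * α₂) (a * β₁ + b * β₂)
  comb-comb {α₁ = α₁} {β₁} {α₂} {β₂} a b (e₁ , e₂ , e₃) (f₁ , f₂ , f₃) = law e₁ f₁ , law e₂ f₂ , law e₃ f₃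
    where
    law : ∀ {x y x′ y′} → x ≈ α₁ * x′ + β₁ * y′ → y ≈ α₂ * x′ + β₂ * y′ →
          a * x + b * y ≈ (a * α₁ + b * α₂) * x′ + (a * β₁ + b * β₂) * y′
    law {x′ = x′} {y′} ex ey = trans (+-cong (*-congˡ ex) (*-congˡ ey))
      (solve 8 (λ a b α₁ β₁ α₂ β₂ x′ y′ → a :* (α₁ :* x′ :+ β₁ :* y′) :+ b :* (α₂ :* x′ :+ β₂ :* y′)
                 := (a :* α₁ :+ b :* α₂) :* x′ :+ (a :* β₁ :+ b :* β₂) :* y′) refl a b α₁ β₁ α₂ β₂ x′ y′)

  comb-1-0 : ∀ u v → u ≈V comb u v 1# 0#
  comb-1-0 (u₁ , u₂ , u₃) (v₁ , v₂ , v₃) = law u₁ v₁ , law u₂ v₂ , law u₃ v₃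
    where
    law : ∀ x y → x ≈ 1# * x + 0# * y
    law = solve 2 (λ x y → x := con 1 :* x :+ con 0 :* y) refl

  comb-0-1 : ∀ u v → v ≈V comb u v 0# 1#
  comb-0-1 (u₁ , u₂ , u₃) (v₁ , v₂ , v₃) = law u₁ v₁ , law u₂ v₂ , law u₃ v₃
    where
    law : ∀ x y → y ≈ 0# * x + 1# * y
    law = solve 2 (λ x y → y := con 0 :* x :+ con 1 :* y) refl

  comb-injective : ∀ {u v} → LinIndep u v → ∀ {α β α′ β′} →
    comb u v α β ≈V comb u v α′ β′ → (α ≈ α′) × (β ≈ β′)
  comb-injective {u₁ , u₂ , u₃} {v₁ , v₂ , v₃} indep {α} {β} {α′} {β′} (e₁ , e₂ , e₃) =
    x∙y⁻¹≈ε⇒x≈y α α′ (proj₁ zero-diff) , x∙y⁻¹≈ε⇒x≈y β β′ (proj₂ zero-diff)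
    where
    law : ∀ {x y} → α * x + β * y ≈ α′ * x + β′ * y → (α - α′) * x + (β - β′) * y ≈ 0#
    law {x} {y} e = begin
      (α - α′) * x + (β - β′) * y                ≈⟨ solve 6 (λ a na b nb x y → (a :+ na) :* x :+ (b :+ nb) :* y
                                                      := (a :* x :+ b :* y) :+ (na :* x :+ nb :* y)) refl α (- α′) β (- β′) x y ⟩
      (α * x + β * y) + (- α′ * x + - β′ * y)    ≈⟨ +-congʳ e ⟩
      (α′ * x + β′ * y) + (- α′ * x + - β′ * y)  ≈⟨ solve 6 (λ a na b nb x y → (a :* x :+ b :* y) :+ (na :* x :+ nb :* y)
                                                      := (a :+ na) :* x :+ (b :+ nb) :* y) refl α′ (- α′) β′ (- β′) x y ⟩
      (α′ - α′) * x + (β′ - β′) * y              ≈⟨ +-cong (*-congʳ (-‿inverseʳ α′)) (*-congʳ (-‿inverseʳ β′)) ⟩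
      0# * x + 0# * y                            ≈⟨ +-cong (zeroˡ x) (zeroˡ y) ⟩
      0# + 0#                                    ≈⟨ +-identityˡ 0# ⟩
      0#                                         ∎
    zero-diff = indep (α - α′) (β - β′) (law e₁ , law e₂ , law e₃)

  module Points (ψ : (v : V) → NonZeroV v → Fin (rOf q)) (bij : IsPointBijection ψ) where

    SamePoint⇒ψ-≡ : ∀ {x y} nx ny → SamePoint x y → ψ x nx ≡ ψ y ny
    SamePoint⇒ψ-≡ {x} {y} nx ny = Equivalence.from (proj₁ bij x y nx ny)

    ψ-≡⇒SamePoint : ∀ {x y} nx ny → ψ x nx ≡ ψ y ny → SamePoint x y
    ψ-≡⇒SamePoint {x} {y} nx ny = Equivalence.to (proj₁ bij x y nx ny)

    ψ-distinct⇒LinIndep : ∀ {u v} nu nv → ψ u nu ≢ ψ v nv → LinIndep u v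
    ψ-distinct⇒LinIndep {u₁ , u₂ , u₃} {v₁ , v₂ , v₃} nu nv ψu≢ψv a b (e₁ , e₂ , e₃) with a ≟F 0#
    ... | no a≉0 = ⊥-elim (ψu≢ψv (SamePoint⇒ψ-≡ nu nv (a′ * - b , solve-for e₁ , solve-for e₂ , solve-for e₃)))
      where
      a′ = proj₁ (inverse a a≉0)
      solve-for : ∀ {x y} → a * x + b * y ≈ 0# → x ≈ (a′ * - b) * y
      solve-for {x} {y} e = begin
        x               ≈⟨ inverse-cancel (proj₂ (inverse a a≉0)) (inverseˡ-unique (a * x) (b * y) e) ⟩
        a′ * - (b * y)  ≈⟨ *-congˡ (-‿distribˡ-* b y) ⟩
        a′ * (- b * y)  ≈⟨ *-assoc a′ (- b) y ⟨
        (a′ * - b) * y  ∎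
    ... | yes a≈0 = a≈0 , b≈0
      where
      drop-a : ∀ {x y} → a * x + b * y ≈ 0# → b * y ≈ 0#
      drop-a {x} {y} e = begin
        b * y           ≈⟨ +-identityˡ (b * y) ⟨
        0# + b * y      ≈⟨ +-congʳ (trans (*-congʳ a≈0) (zeroˡ x)) ⟨
        a * x + b * y   ≈⟨ e ⟩
        0#              ∎
      b≈0 : b ≈ 0#
      b≈0 with b ≟F 0#
      ... | yes b≈0 = b≈0
      ... | no b≉0  = ⊥-elim (nv (nonzero-*-cancel b≉0 (drop-a e₁) ,
                                  nonzero-*-cancel b≉0 (drop-a e₂) ,
                                  nonzero-*-cancel b≉0 (drop-a e₃)))

    -- representatives of the q + 1 points on span(u, v): u, and e u + v for every scalar e
    module Line {u v : V} (indep : LinIndep u v) where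
      coeffs : Fin (suc q) → Carrier × Carrier
      coeffs Fin.zero    = 1# , 0#
      coeffs (Fin.suc j) = element j , 1#

      point : Fin (suc q) → V
      point j = comb u v (proj₁ (coeffs j)) (proj₂ (coeffs j))

      point-nonzero : ∀ j → NonZeroV (point j)
      point-nonzero Fin.zero    p≈0 = 1≉0 (proj₁ (indep 1# 0# p≈0))
      point-nonzero (Fin.suc j) p≈0 = 1≉0 (proj₂ (indep (element j) 1# p≈0))

      image : Fin (suc q) → Fin (rOf q)
      image j = ψ (point j) (point-nonzero j)

      image-injective : ∀ {i j} → image i ≡ image j → i ≡ j
      image-injective {i} {j} eq with ψ-≡⇒SamePoint (point-nonzero i) (point-nonzero j) eq
      ... | c , pᵢ≈cpⱼ = same-coeffs i j (comb-injective indep (≈V-trans pᵢ≈cpⱼ (·-comb c u v _ _)))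
        where
        same-coeffs : ∀ i j → let (α , β) = coeffs i; (α′ , β′) = coeffs j in
          (α ≈ c * α′) × (β ≈ c * β′) → i ≡ j
        same-coeffs Fin.zero    Fin.zero    _         = ≡.refl
        same-coeffs Fin.zero    (Fin.suc j) (1≈c·e , 0≈c·1) =
          ⊥-elim (1≉0 (trans 1≈c·e (trans (*-congʳ (trans (sym (*-identityʳ c)) (sym 0≈c·1))) (zeroˡ (element j)))))
        same-coeffs (Fin.suc i) Fin.zero    (_ , 1≈c·0) = ⊥-elim (1≉0 (trans 1≈c·0 (zeroʳ c)))
        same-coeffs (Fin.suc i) (Fin.suc j) (eᵢ≈c·eⱼ , 1≈c·1) = ≡.cong Fin.suc (element-injective
          (trans eᵢ≈c·eⱼ (trans (*-congʳ (trans (sym (*-identityʳ c)) (sym 1≈c·1))) (*-identityˡ (element j)))))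

      OnLine : Fin (rOf q) → Set
      OnLine k = ∃[ x ] ∃[ nx ] (InSpan u v x × (ψ x nx ≡ k))

      OnLine⇔image : ∀ k → OnLine k ⇔ (∃[ j ] image j ≡ k)
      OnLine⇔image k = mk⇔ to from
        where
        from : ∃[ j ] image j ≡ k → OnLine k
        from (j , eq) = point j , point-nonzero j , (_ , _ , comb-cong u v refl refl) , eq
        through : ∀ {x} nx j → SamePoint x (point j) → ψ x nx ≡ k → ∃[ j ] image j ≡ k
        through nx j same eq = j , ≡.trans (≡.sym (SamePoint⇒ψ-≡ nx (point-nonzero j) same)) eq
        to : OnLine k → ∃[ j ] image j ≡ k
        to (x , nx , (a , b , x≈) , eq) with b ≟F 0#
        ... | yes b≈0 = through nx Fin.zero (a , ≈V-trans x≈ (≈V-sym (≈V-trans (·-comb a u v 1# 0#)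
                          (comb-cong u v (*-identityʳ a) (trans (zeroʳ a) (sym b≈0)))))) eq
        ... | no b≉0 with inverse b b≉0
        ...   | b′ , bb′≈1 = through nx (Fin.suc j) (b , ≈V-trans x≈ (≈V-sym (≈V-trans (·-comb b u v (element j) 1#)
                               (comb-cong u v b·e≈a (*-identityʳ b))))) eq
          where
          j = E.to (a * b′)
          b·e≈a : b * element j ≈ a
          b·e≈a = begin
            b * element j   ≈⟨ *-congˡ (E.injective (to-element j)) ⟩
            b * (a * b′)    ≈⟨ solve 3 (λ a b b′ → b :* (a :* b′) := a :* (b :* b′)) refl a b b′ ⟩
            a * (b * b′)    ≈⟨ *-congˡ bb′≈1 ⟩
            a * 1#          ≈⟨ *-identityʳ a ⟩
            a               ∎

    line-size : ∀ {ℓ} → IsLineImage ψ ℓ → length (sortedElems ℓ) ≡ suc q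
    line-size {ℓ} (u , v , indep , ∈ℓ⇔) =
      length-sortedElems-image image image-injective ℓ (λ k → ⇔-trans (∈ℓ⇔ k) (OnLine⇔image k))
      where open Line indep

    InSpan-scale : ∀ {u v x y} c → y ≈V (c · x) → InSpan u v x → InSpan u v y
    InSpan-scale {u} {v} c y≈cx (a , b , x≈) =
      c * a , c * b , ≈V-trans y≈cx (≈V-trans (·-congˡ c x≈) (·-comb c u v a b))

    InSpan-trans : ∀ {u′ v′ u v x} → InSpan u′ v′ u → InSpan u′ v′ v → InSpan u v x → InSpan u′ v′ x
    InSpan-trans (_ , _ , u≈) (_ , _ , v≈) (a , b , x≈) = _ , _ , ≈V-trans x≈ (comb-comb a b u≈ v≈)

    _≟ₛ_ : DecidableEquality (Subset (rOf q))
    _≟ₛ_ = ≡-dec _≟ᵇ_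

    module Joining {a b : Fin (rOf q)} (a≢b : a ≢ b) where
      private
        u = proj₁ (proj₂ bij a)
        nu = proj₁ (proj₂ (proj₂ bij a))
        ψu≡a = proj₂ (proj₂ (proj₂ bij a))
        v = proj₁ (proj₂ bij b)
        nv = proj₁ (proj₂ (proj₂ bij b))
        ψv≡b = proj₂ (proj₂ (proj₂ bij b))

      indep : LinIndep u v
      indep = ψ-distinct⇒LinIndep nu nv (λ eq → a≢b (≡.trans (≡.sym ψu≡a) (≡.trans eq ψv≡b)))

      open Line indep

      image? : ∀ k → Dec (∃[ j ] image j ≡ k)
      image? k = Fin.any? (λ j → image j Fin.≟ k)

      joining-line : Subset (rOf q)
      joining-line = subsetOf image?

      ∈joining-line⇔OnLine : ∀ k → (k ∈ₛ joining-line) ⇔ OnLine k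
      ∈joining-line⇔OnLine k = ⇔-trans (∈-subsetOf image? k) (⇔-sym (OnLine⇔image k))

      joining-line-isLine : IsLineImage ψ joining-line
      joining-line-isLine = u , v , indep , ∈joining-line⇔OnLine

      a∈joining-line : a ∈ₛ joining-line
      a∈joining-line = Equivalence.from (∈joining-line⇔OnLine a) (u , nu , (1# , 0# , comb-1-0 u v) , ψu≡a)

      b∈joining-line : b ∈ₛ joining-line
      b∈joining-line = Equivalence.from (∈joining-line⇔OnLine b) (v , nv , (0# , 1# , comb-0-1 u v) , ψv≡b)

      joining-line-unique : ∀ {ℓ} → IsLineImage ψ ℓ → a ∈ₛ ℓ → b ∈ₛ ℓ → joining-line ≡ ℓ
      joining-line-unique {ℓ} line@(u′ , v′ , _ , ∈ℓ⇔) a∈ℓ b∈ℓ =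
        ⊆-length-sortedElems⇒≡ joining-line ℓ joining⊆ℓ
          (≡.trans (line-size joining-line-isLine) (≡.sym (line-size line)))
        where
        in-span : ∀ {w} nw {k} → ψ w nw ≡ k → k ∈ₛ ℓ → InSpan u′ v′ w
        in-span nw ψw≡k k∈ℓ with Equivalence.to (∈ℓ⇔ _) k∈ℓ
        ... | x , nx , x∈span , ψx≡k with ψ-≡⇒SamePoint nw nx (≡.trans ψw≡k (≡.sym ψx≡k))
        ...   | c , w≈cx = InSpan-scale c w≈cx x∈span
        joining⊆ℓ : ∀ {k} → k ∈ₛ joining-line → k ∈ₛ ℓ
        joining⊆ℓ {k} k∈ with Equivalence.to (∈joining-line⇔OnLine k) k∈
        ... | x , nx , x∈span , ψx≡k = Equivalence.from (∈ℓ⇔ k)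
          (x , nx , InSpan-trans (in-span nu ψu≡a a∈ℓ) (in-span nv ψv≡b b∈ℓ) x∈span , ψx≡k)

    lines-isSteinerSystem : {L : List (Subset (rOf q))} → Unique L →
      (∀ ℓ → (ℓ ∈ L) ⇔ IsLineImage ψ ℓ) → IsSteinerSystem (suc q) L
    lines-isSteinerSystem {L} unique ∈L⇔ = record
      { block-size  = All.tabulate (λ ℓ∈L → line-size (Equivalence.to (∈L⇔ _) ℓ∈L))
      ; pair-unique = pair-unique
      }
      where
      pair-unique : ∀ {a b} → a ≢ b → sum (λ ℓ → 𝟙 (a ∈? ℓ) ℤ.* 𝟙 (b ∈? ℓ)) L ≡ + 1
      pair-unique {a} {b} a≢b = ≡.trans (sum-congᴬ (All.tabulate λ {ℓ} → is-joining-line ℓ))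
        (sum-𝟙-≟ _≟ₛ_ joining-line unique (Equivalence.from (∈L⇔ _) joining-line-isLine))
        where
        open Joining a≢b
        is-joining-line : ∀ ℓ → ℓ ∈ L → 𝟙 (a ∈? ℓ) ℤ.* 𝟙 (b ∈? ℓ) ≡ 𝟙 (ℓ ≟ₛ joining-line)
        is-joining-line ℓ ℓ∈L with a ∈? ℓ | b ∈? ℓ | ℓ ≟ₛ joining-line
        ... | yes a∈ℓ | yes b∈ℓ | no ≢ℓ = ⊥-elim (≢ℓ (≡.sym (joining-line-unique (Equivalence.to (∈L⇔ ℓ) ℓ∈L) a∈ℓ b∈ℓ)))
        ... | yes _   | yes _   | yes _ = ≡.refl
        ... | no a∉ℓ  | _       | yes ≡.refl = ⊥-elim (a∉ℓ a∈joining-line)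
        ... | yes _   | no b∉ℓ  | yes ≡.refl = ⊥-elim (b∉ℓ b∈joining-line)
        ... | no _    | _       | no _  = ≡.refl
        ... | yes _   | no _    | no _  = ≡.refl

open import Data.Integer using (_+_; _*_; +_)
open import Data.Fin using (Fin)
open import Data.Fin.Subset using (Subset)
open import Data.List using (List)
open import Data.List.Membership.Propositional using (_∈_)
open import Data.List.Relation.Unary.Unique.Propositional using (Unique)
open import Data.Product using (_×_)
open import Relation.Binary.PropositionalEquality using (_≡_)
open import Function.Bundles using (_⇔_)

open import Data.Nat using (zero; suc)
open import Function.Bundles using (Bijection)

lemma4p3 : {q : ℕ} (F : FiniteField q)
    → (ψ : (v : PG.V F) → PG.NonZeroV F v → Fin (rOf q))
    → PG.IsPointBijection F ψ
    → (L : List (Subset (rOf q)))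
    → Unique L
    → (∀ ℓ → (ℓ ∈ L) ⇔ PG.IsLineImage F ψ ℓ)
    → (E₁ q L + E₄ q L ≡ E₂ q L + E₃ q L)
    × ((+ 2) * (E₁ q L + E₄ q L) ≡ E₅ q)
    × ((+ 2) * (E₂ q L + E₃ q L) ≡ E₅ q)
-- q = 0 is impossible: 0# would be an element of Fin 0
lemma4p3 {zero} F ψ bij L unique ∈L⇔ with Bijection.to (FiniteField.enum F) (FiniteField.0# F)
... | ()
lemma4p3 {suc p} F ψ bij L unique ∈L⇔ = Counting.E-identities p (lines-isSteinerSystem unique ∈L⇔)
  where open ProjectivePlane.Points F ψ bij
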